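{- If $G\in\mathcal B(n)$ is triangle-connected, then $|\mathcal P(G)|\le 2$.
   Context: Consider the $2n$ literals $x_1,\bar x_1,\dots,x_n,\bar x_n$ (with $\bar{\bar x}=x$). $\mathcal P(n)$ is the set of partial orders $P$ on these literals such that (b) each pair $x_i,\bar x_i$ is incomparable, and (c) $x<y$ iff $\bar y<\bar x$. Write $x\lessdot y$ if $x<y$ and no $z$ has $x<z<y$. For $P\in\mathcal P(n)$, $G(P)$ is the colored graph on vertex set $[n]$ having a red edge $ij$ whenever $x_i\lessdot\bar x_j$ or $\bar x_i\lessdot x_j$, and a blue edge $ij$ whenever $x_i\lessdot x_j$ or $\bar x_i\lessdot\bar x_j$. For a colored graph $G$ on $[n]$, $\mathcal P(G)=\{P\in\mathcal P(n):G(P)=G\}$. A colored graph is blue-bipartite if its vertex set has a partition $U\sqcup W$ with every blue edge joining $U$ to $W$ and every red edge inside $U$ or inside $W$; $\mathcal B(n)$ is the set of blue-bipartite colored graphs on $[n]$. Two edges $e,f$ of $G$ are triangle-equivalent if $e=f$ or there is a sequence of triangles $T_1,\dots,T_l$ of $G$ with $e\in T_1$, $f\in T_l$ and $T_{i-1},T_i$ sharing an edge for each $i$; $G$ is triangle-connected if all its edges are triangle-equivalent (one equivalence class). -}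

module Defs where

open import Data.Nat using (ℕ)
open import Data.Fin using (Fin)
open import Data.Bool using (Bool; true; false; not)
open import Data.Product using (Σ; _×_; _,_; ∃)
open import Data.Sum using (_⊎_)
open import Relation.Nullary using (¬_)
open import Relation.Binary.PropositionalEquality using (_≡_; _≢_)
open import Relation.Binary.Construct.Closure.ReflexiveTransitive using (Star)
open import Function.Bundles using (_⇔_)

-- Literals: (i , true) is x_i and (i , false) is x̄_i.
Lit : ℕ → Set
Lit n = Fin n × Bool

neg : ∀ {n} → Lit n → Lit n
neg (i , b) = (i , not b)

Rel : ℕ → Set
Rel n = Lit n → Lit n → Bool

_<[_]_ : ∀ {n} → Lit n → Rel n → Lit n → Set
x <[ P ] y = P x y ≡ true

record InPn {n : ℕ} (P : Rel n) : Set where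
  field
    irrefl    : ∀ x → ¬ (x <[ P ] x)
    trans     : ∀ x y z → x <[ P ] y → y <[ P ] z → x <[ P ] z
    incompar  : ∀ x → ¬ (x <[ P ] neg x)
    antiInvol : ∀ x y → P x y ≡ P (neg y) (neg x)

Cov : ∀ {n} → Rel n → Lit n → Lit n → Set
Cov P x y = x <[ P ] y × (∀ z → ¬ (x <[ P ] z × z <[ P ] y))

record CGraph (n : ℕ) : Set where
  field
    red  : Fin n → Fin n → Bool
    blue : Fin n → Fin n → Bool

record IsSimple {n : ℕ} (G : CGraph n) : Set where
  open CGraph G
  field
    red-sym    : ∀ i j → red i j ≡ red j i
    blue-sym   : ∀ i j → blue i j ≡ blue j i
    red-noloop : ∀ i → red i i ≡ false
    blue-noloop : ∀ i → blue i i ≡ false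

GraphOf≡ : ∀ {n} → Rel n → CGraph n → Set
GraphOf≡ {n} P G =
  (∀ (i j : Fin n) → (CGraph.red G i j ≡ true) ⇔
     (Cov P (i , true) (j , false) ⊎ Cov P (i , false) (j , true)))
  × (∀ (i j : Fin n) → (CGraph.blue G i j ≡ true) ⇔
     (Cov P (i , true) (j , true) ⊎ Cov P (i , false) (j , false)))

InPG : ∀ {n} → CGraph n → Rel n → Set
InPG G P = InPn P × GraphOf≡ P G

-- blue-bipartite (U = vertices with side true, W = side false)
BlueBipartite : ∀ {n} → CGraph n → Set
BlueBipartite {n} G = Σ (Fin n → Bool) λ side →
  (∀ i j → CGraph.blue G i j ≡ true → side i ≢ side j)
  × (∀ i j → CGraph.red G i j ≡ true → side i ≡ side j)

InBn : ∀ {n} → CGraph n → Set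
InBn G = IsSimple G × BlueBipartite G

Adj : ∀ {n} → CGraph n → Fin n → Fin n → Set
Adj G i j = (CGraph.red G i j ≡ true) ⊎ (CGraph.blue G i j ≡ true)

-- an edge, given by an ordered pair of adjacent vertices (represents {i , j})
Edge : ∀ {n} → CGraph n → Set
Edge {n} G = Σ (Fin n × Fin n) λ { (i , j) → Adj G i j }

SameEdge : ∀ {n} {G : CGraph n} → Edge G → Edge G → Set
SameEdge ((i , j) , _) ((k , l) , _) = (i ≡ k × j ≡ l) ⊎ (i ≡ l × j ≡ k)

Triangle : ∀ {n} → CGraph n → Set
Triangle {n} G = Σ (Fin n × Fin n × Fin n) λ { (a , b , c) →
  Adj G a b × Adj G b c × Adj G a c }

InTri : ∀ {n} → Fin n → Fin n → Fin n → Fin n → Set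
InTri v a b c = v ≡ a ⊎ v ≡ b ⊎ v ≡ c

EdgeIn : ∀ {n} {G : CGraph n} → Edge G → Triangle G → Set
EdgeIn ((i , j) , _) ((a , b , c) , _) = InTri i a b c × InTri j a b c

ShareEdge : ∀ {n} {G : CGraph n} → Triangle G → Triangle G → Set
ShareEdge {G = G} T T' = Σ (Edge G) λ e → EdgeIn e T × EdgeIn e T'

TriEquiv : ∀ {n} {G : CGraph n} → Edge G → Edge G → Set
TriEquiv {G = G} e f = SameEdge e f ⊎
  Σ (Triangle G) λ T₁ → Σ (Triangle G) λ Tₗ →
    EdgeIn e T₁ × EdgeIn f Tₗ × Star (ShareEdge {G = G}) T₁ Tₗ

TriangleConnected : ∀ {n} → CGraph n → Set
TriangleConnected G = ∀ (e f : Edge G) → TriEquiv e f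

-- pointwise equality of relations (two orders are the same element of 𝒫(n))
_≈R_ : ∀ {n} → Rel n → Rel n → Set
P ≈R Q = ∀ x y → P x y ≡ Q x y

-- Give the literal (i , b) the polarity b xor side(i). Blue-bipartiteness says exactly that every cover
-- x ⋖ y of P ∈ 𝒫(G) goes from some polarity s to the opposite one; equivalently, the literal of polarity s
-- at i lies below the negation of the literal of polarity s at j, and we say that P orients the edge ij
-- by s. The three edges of a triangle are oriented alike (otherwise some literal would lie below its own
-- negation), so on a triangle-connected graph P orients every edge by one and the same s. Then no two
-- covers compose, so P is its own cover relation, and its covers are determined by G and s. Of three
-- orders two share s, and these two are equal.
module Submission where

open import Defs
open import Data.Nat using (ℕ)
open import Data.Fin using (Fin)
open import Data.Fin.Properties using (any?) renaming (_≟_ to _≟ᶠ_)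
open import Data.Bool using (Bool; true; false; not; _xor_)
open import Data.Bool.Properties
  using (_≟_; not-involutive; not-¬; ¬-not; not-distribˡ-xor; xor-assoc; xor-same; xor-identityʳ; ⇔→≡)
open import Data.Product using (Σ; Σ-syntax; _×_; _,_; proj₁; proj₂)
open import Data.Product.Properties using (≡-dec)
open import Data.Sum using (_⊎_; inj₁; inj₂; [_,_]; swap)
open import Data.Empty using (⊥; ⊥-elim)
open import Data.List using (List; []; _∷_; allFin; cartesianProduct)
open import Data.List.Membership.Propositional using (_∈_)
open import Data.List.Membership.Propositional.Properties using (∈-allFin; ∈-cartesianProduct⁺)
open import Data.List.Relation.Unary.Any using (here; there)
open import Function using (id; _∘_)
open import Function.Bundles using (Equivalence; mk⇔)
open import Relation.Nullary using (¬_; Dec; yes; no)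
open import Relation.Nullary.Decidable using (_×-dec_; _⊎-dec_)
open import Relation.Unary using (Decidable)
open import Relation.Binary.PropositionalEquality
  using (_≡_; refl; sym; trans; cong; subst; subst₂; module ≡-Reasoning)
open import Relation.Binary.Construct.Closure.ReflexiveTransitive using (Star; ε; _◅_)

open Equivalence using (to; from)

Bool-pigeonhole : ∀ (a b c : Bool) → a ≡ b ⊎ a ≡ c ⊎ b ≡ c
Bool-pigeonhole true  true  _     = inj₁ refl
Bool-pigeonhole false false _     = inj₁ refl
Bool-pigeonhole true  false true  = inj₂ (inj₁ refl)
Bool-pigeonhole true  false false = inj₂ (inj₂ refl)
Bool-pigeonhole false true  true  = inj₂ (inj₂ refl)
Bool-pigeonhole false true  false = inj₂ (inj₁ refl)

neg-involutive : ∀ {n} (x : Lit n) → neg (neg x) ≡ x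
neg-involutive (i , b) = cong (i ,_) (not-involutive b)

allLits : ∀ n → List (Lit n)
allLits n = cartesianProduct (allFin n) (true ∷ false ∷ [])

∈-allLits : ∀ {n} (x : Lit n) → x ∈ allLits n
∈-allLits (i , true)  = ∈-cartesianProduct⁺ (∈-allFin i) (here refl)
∈-allLits (i , false) = ∈-cartesianProduct⁺ (∈-allFin i) (there (here refl))

adj? : ∀ {n} (G : CGraph n) i j → Dec (Adj G i j)
adj? G i j = (CGraph.red G i j ≟ true) ⊎-dec (CGraph.blue G i j ≟ true)

⋖-transfer : ∀ {n} {G : CGraph n} {P Q : Rel n} {x y : Lit n} → GraphOf≡ P G → GraphOf≡ Q G →
  Cov P x y → Cov Q x y ⊎ Cov Q (neg x) (neg y)
⋖-transfer {x = i , true}  {j , false} P≡ Q≡ x⋖y = to (proj₁ Q≡ i j) (from (proj₁ P≡ i j) (inj₁ x⋖y))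
⋖-transfer {x = i , false} {j , true}  P≡ Q≡ x⋖y = swap (to (proj₁ Q≡ i j) (from (proj₁ P≡ i j) (inj₂ x⋖y)))
⋖-transfer {x = i , true}  {j , true}  P≡ Q≡ x⋖y = to (proj₂ Q≡ i j) (from (proj₂ P≡ i j) (inj₁ x⋖y))
⋖-transfer {x = i , false} {j , false} P≡ Q≡ x⋖y = swap (to (proj₂ Q≡ i j) (from (proj₂ P≡ i j) (inj₂ x⋖y)))

module StrictOrder {n : ℕ} {P : Rel n} (P∈ : InPn P) where
  open InPn P∈ public using (irrefl; incompar; antiInvol)

  _<_ : Lit n → Lit n → Set
  x < y = x <[ P ] y

  _⋖_ : Lit n → Lit n → Set
  _⋖_ = Cov P

  private variable x y z : Lit n

  <-trans : x < y → y < z → x < z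
  <-trans = InPn.trans P∈ _ _ _

  <-contra : x < y → neg y < neg x
  <-contra {x} {y} x<y = trans (sym (antiInvol x y)) x<y

  <-swapʳ : x < neg y → y < neg x
  <-swapʳ {x} {y} x<ȳ = subst (_< neg x) (neg-involutive y) (<-contra x<ȳ)

  <-swapˡ : neg x < y → neg y < x
  <-swapˡ {x} {y} x̄<y = subst (neg y <_) (neg-involutive x) (<-contra x̄<y)

  ¬neg<self : ¬ (neg x < x)
  ¬neg<self {x} x̄<x = incompar (neg x) (subst (neg x <_) (sym (neg-involutive x)) x̄<x)

  minimal-in : {S : Lit n → Set} → Decidable S → (ws : List (Lit n)) → S y →
    Σ[ m ∈ Lit n ] S m × (∀ {w} → w ∈ ws → S w → ¬ (w < m))
  minimal-in S? [] Sy = _ , Sy , λ ()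
  minimal-in S? (w ∷ ws) Sy with minimal-in S? ws Sy
  ... | m , Sm , m-min with S? w ×-dec (P w m ≟ true)
  ... | yes (Sw , w<m) = w , Sw , λ
    { (here refl) _ w<w    → irrefl w w<w
    ; (there v∈ws) Sv v<w → m-min v∈ws Sv (<-trans v<w w<m) }
  ... | no ¬Sw×w<m = m , Sm , λ
    { (here refl) Sw w<m  → ¬Sw×w<m (Sw , w<m)
    ; (there v∈ws) Sv v<m → m-min v∈ws Sv v<m }

  cover-below : x < y → Σ[ c ∈ Lit n ] x ⋖ c × (c ≡ y ⊎ c < y)
  cover-below {x} {y} x<y with minimal-in Between? (allLits n) (x<y , inj₁ refl)
    where
    Between : Lit n → Set
    Between w = x < w × (w ≡ y ⊎ w < y)
    Between? : Decidable Between
    Between? w = (P x w ≟ true) ×-dec (≡-dec _≟ᶠ_ _≟_ w y ⊎-dec (P w y ≟ true))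
  ... | c , (x<c , c≤y) , c-min = c , (x<c , ¬between) , c≤y
    where
    ¬between : ∀ z → ¬ (x < z × z < c)
    ¬between z (x<z , z<c) = c-min (∈-allLits z) (x<z , inj₂ (below-c≤y c≤y)) z<c
      where
      below-c≤y : c ≡ y ⊎ c < y → z < y
      below-c≤y (inj₁ refl) = z<c
      below-c≤y (inj₂ c<y)  = <-trans z<c c<y

  no-⋖-chain⇒<⇒⋖ : (∀ {x y z} → x ⋖ y → y ⋖ z → ⊥) → x < y → x ⋖ y
  no-⋖-chain⇒<⇒⋖ no-chain x<y with cover-below x<y
  ... | c , x⋖c , inj₁ refl = x⋖c
  ... | c , x⋖c , inj₂ c<y  = ⊥-elim (no-chain x⋖c (proj₁ (proj₂ (cover-below c<y))))

module BlueBipartition {n : ℕ} {G : CGraph n} (bip : BlueBipartite G) where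
  side : Fin n → Bool
  side = proj₁ bip

  private variable
    s t : Bool
    a b c i j k l : Fin n
    x y z : Lit n

  polarity : Lit n → Bool
  polarity (i , b) = b xor side i

  lit : Bool → Fin n → Lit n
  lit s i = (i , s xor side i)

  polarity-neg : ∀ x → polarity (neg x) ≡ not (polarity x)
  polarity-neg (i , b) = sym (not-distribˡ-xor b (side i))

  lit-polarity : ∀ x → lit (polarity x) (proj₁ x) ≡ x
  lit-polarity (i , b) = cong (i ,_) (begin
    (b xor side i) xor side i ≡⟨ xor-assoc b (side i) (side i) ⟩
    b xor (side i xor side i) ≡⟨ cong (b xor_) (xor-same (side i)) ⟩
    b xor false               ≡⟨ xor-identityʳ b ⟩
    b                         ∎)
    where open ≡-Reasoning

  neg-lit : ∀ s i → neg (lit s i) ≡ lit (not s) i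
  neg-lit s i = cong (i ,_) (not-distribˡ-xor s (side i))

  red⇒same-side : CGraph.red G i j ≡ true → side i ≡ side j
  red⇒same-side = proj₂ (proj₂ bip) _ _

  blue⇒side-flip : CGraph.blue G i j ≡ true → side j ≡ not (side i)
  blue⇒side-flip blue = ¬-not (proj₁ (proj₂ bip) _ _ blue ∘ sym)

  -- A record rather than a synonym, so that s, i and j can be inferred from a proof.
  record Oriented (P : Rel n) (s : Bool) (i j : Fin n) : Set where
    constructor oriented
    field below : lit s i <[ P ] neg (lit s j)

  UniformlyOriented : Rel n → Bool → Set
  UniformlyOriented P s = ∀ i j → Adj G i j → Oriented P s i j

  module Orientation {P : Rel n} (P∈G : InPG G P) where
    open StrictOrder (proj₁ P∈G)
    open Oriented

    private
      G≡ : GraphOf≡ P G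
      G≡ = proj₂ P∈G

    ⋖⇒red : ∀ {b} → (i , b) ⋖ (j , not b) → CGraph.red G i j ≡ true
    ⋖⇒red {i} {j} {true}  x⋖y = from (proj₁ G≡ i j) (inj₁ x⋖y)
    ⋖⇒red {i} {j} {false} x⋖y = from (proj₁ G≡ i j) (inj₂ x⋖y)

    ⋖⇒blue : ∀ {b} → (i , b) ⋖ (j , b) → CGraph.blue G i j ≡ true
    ⋖⇒blue {i} {j} {true}  x⋖y = from (proj₂ G≡ i j) (inj₁ x⋖y)
    ⋖⇒blue {i} {j} {false} x⋖y = from (proj₂ G≡ i j) (inj₂ x⋖y)

    ⋖⇒adj : x ⋖ y → Adj G (proj₁ x) (proj₁ y)
    ⋖⇒adj {_ , true}  {_ , false} x⋖y = inj₁ (⋖⇒red x⋖y)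
    ⋖⇒adj {_ , false} {_ , true}  x⋖y = inj₁ (⋖⇒red x⋖y)
    ⋖⇒adj {_ , true}  {_ , true}  x⋖y = inj₂ (⋖⇒blue x⋖y)
    ⋖⇒adj {_ , false} {_ , false} x⋖y = inj₂ (⋖⇒blue x⋖y)

    ⋖⇒polarity-flip : x ⋖ y → polarity y ≡ not (polarity x)
    ⋖⇒polarity-flip {i , true}  {_ , false} x⋖y =
      trans (sym (red⇒same-side (⋖⇒red x⋖y))) (sym (not-involutive (side i)))
    ⋖⇒polarity-flip {_ , false} {_ , true}  x⋖y = cong not (sym (red⇒same-side (⋖⇒red x⋖y)))
    ⋖⇒polarity-flip {_ , true}  {_ , true}  x⋖y = cong not (blue⇒side-flip (⋖⇒blue x⋖y))
    ⋖⇒polarity-flip {_ , false} {_ , false} x⋖y = blue⇒side-flip (⋖⇒blue x⋖y)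

    ⋖⇒oriented : x ⋖ y → Oriented P (polarity x) (proj₁ x) (proj₁ y)
    ⋖⇒oriented {x} {y} x⋖y = oriented (subst₂ _<_ (sym (lit-polarity x)) (sym upper) (proj₁ x⋖y))
      where
      open ≡-Reasoning
      upper : neg (lit (polarity x) (proj₁ y)) ≡ y
      upper = begin
        neg (lit (polarity x) (proj₁ y)) ≡⟨ neg-lit (polarity x) (proj₁ y) ⟩
        lit (not (polarity x)) (proj₁ y) ≡⟨ cong (λ s → lit s (proj₁ y)) (sym (⋖⇒polarity-flip x⋖y)) ⟩
        lit (polarity y) (proj₁ y)       ≡⟨ lit-polarity y ⟩
        y                                ∎

    Linked : Fin n → Fin n → Set
    Linked i j = Σ Bool λ s → Oriented P s i j

    adj⇒linked : Adj G i j → Linked i j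
    adj⇒linked {i} {j} (inj₁ red) with to (proj₁ G≡ i j) red
    ... | inj₁ x⋖y = _ , ⋖⇒oriented x⋖y
    ... | inj₂ x⋖y = _ , ⋖⇒oriented x⋖y
    adj⇒linked {i} {j} (inj₂ blue) with to (proj₂ G≡ i j) blue
    ... | inj₁ x⋖y = _ , ⋖⇒oriented x⋖y
    ... | inj₂ x⋖y = _ , ⋖⇒oriented x⋖y

    ¬adj-loop : ¬ Adj G i i
    ¬adj-loop adj = incompar _ (below (proj₂ (adj⇒linked adj)))

    Against : Bool → Fin n → Fin n → Set
    Against s i j = neg (lit s i) < lit s j

    oriented-sym : Oriented P s i j → Oriented P s j i
    oriented-sym (oriented o) = oriented (<-swapʳ o)

    linked-sym : Linked i j → Linked j i
    linked-sym (s , o) = s , oriented-sym o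

    ¬oriented×against : Oriented P s i j → Against s i j → ⊥
    ¬oriented×against (oriented o) a = irrefl _ (<-trans o (<-swapˡ a))

    oriented-not⇒against : Oriented P (not s) i j → Against s i j
    oriented-not⇒against {s} {i} {j} (oriented o) =
      subst₂ _<_ (sym (neg-lit s i)) (trans (cong neg (sym (neg-lit s j))) (neg-involutive (lit s j))) o

    oriented-dichotomy : Oriented P t i j → t ≡ s ⊎ Against s i j
    oriented-dichotomy {t} {s = s} o with t ≟ s
    ... | yes t≡s = inj₁ t≡s
    ... | no t≢s  = inj₂ (oriented-not⇒against (subst (λ t → Oriented P t _ _) (¬-not t≢s) o))

    oriented-unique : Oriented P t i j → Oriented P s i j → t ≡ s
    oriented-unique {s = s} oₜ oₛ = [ id , ⊥-elim ∘ ¬oriented×against oₛ ] (oriented-dichotomy {s = s} oₜ)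

    oriented-triangle : Oriented P s i j → Linked j k → Linked i k → Oriented P s j k
    oriented-triangle {s = s} oᵢⱼ (_ , oⱼₖ) (_ , oᵢₖ) with oriented-dichotomy {s = s} oⱼₖ
    ... | inj₁ refl = oⱼₖ
    ... | inj₂ aⱼₖ with oriented-dichotomy {s = s} oᵢₖ
    ...   | inj₁ refl = ⊥-elim (incompar _ (<-trans (below oᵢₖ) (<-contra (<-trans (below oᵢⱼ) aⱼₖ))))
    ...   | inj₂ aᵢₖ  = ⊥-elim (¬neg<self (<-trans (<-swapˡ aᵢₖ) (<-trans (below oᵢⱼ) aⱼₖ)))

    -- SameEdge on the underlying vertex pairs, to which it reduces definitionally.
    SamePair : Fin n → Fin n → Fin n → Fin n → Set
    SamePair i j k l = (i ≡ k × j ≡ l) ⊎ (i ≡ l × j ≡ k)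

    samePair-sym : SamePair i j k l → SamePair k l i j
    samePair-sym (inj₁ (i≡k , j≡l)) = inj₁ (sym i≡k , sym j≡l)
    samePair-sym (inj₂ (i≡l , j≡k)) = inj₂ (sym j≡k , sym i≡l)

    samePair-oriented : SamePair i j k l → Oriented P s i j → Oriented P s k l
    samePair-oriented (inj₁ (refl , refl)) = id
    samePair-oriented (inj₂ (refl , refl)) = oriented-sym

    edge-is-side : Adj G i j → InTri i a b c → InTri j a b c →
      SamePair i j a b ⊎ SamePair i j b c ⊎ SamePair i j a c
    edge-is-side loop (inj₁ refl)        (inj₁ refl)        = ⊥-elim (¬adj-loop loop)
    edge-is-side _    (inj₁ refl)        (inj₂ (inj₁ refl)) = inj₁ (inj₁ (refl , refl))
    edge-is-side _    (inj₁ refl)        (inj₂ (inj₂ refl)) = inj₂ (inj₂ (inj₁ (refl , refl)))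
    edge-is-side _    (inj₂ (inj₁ refl)) (inj₁ refl)        = inj₁ (inj₂ (refl , refl))
    edge-is-side loop (inj₂ (inj₁ refl)) (inj₂ (inj₁ refl)) = ⊥-elim (¬adj-loop loop)
    edge-is-side _    (inj₂ (inj₁ refl)) (inj₂ (inj₂ refl)) = inj₂ (inj₁ (inj₁ (refl , refl)))
    edge-is-side _    (inj₂ (inj₂ refl)) (inj₁ refl)        = inj₂ (inj₂ (inj₂ (refl , refl)))
    edge-is-side _    (inj₂ (inj₂ refl)) (inj₂ (inj₁ refl)) = inj₂ (inj₁ (inj₂ (refl , refl)))
    edge-is-side loop (inj₂ (inj₂ refl)) (inj₂ (inj₂ refl)) = ⊥-elim (¬adj-loop loop)

    AllOriented : Bool → Fin n × Fin n × Fin n → Set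
    AllOriented s (a , b , c) = Oriented P s a b × Oriented P s b c × Oriented P s a c

    triangle-oriented : Adj G a b → Adj G b c → Adj G a c →
      Adj G i j → InTri i a b c → InTri j a b c → Oriented P s i j → AllOriented s (a , b , c)
    triangle-oriented {a = a} {b = b} {c = c} {i = i} {j = j} {s = s} ab bc ac ij i∈T j∈T oᵢⱼ =
      from-ab (side-ab (edge-is-side ij i∈T j∈T))
      where
      lab : Linked a b
      lab = adj⇒linked ab
      lbc : Linked b c
      lbc = adj⇒linked bc
      lac : Linked a c
      lac = adj⇒linked ac
      from-ab : Oriented P s a b → AllOriented s (a , b , c)
      from-ab o = o , oriented-triangle o lbc lac , oriented-triangle (oriented-sym o) lac lbc
      side-ab : SamePair i j a b ⊎ SamePair i j b c ⊎ SamePair i j a c → Oriented P s a b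
      side-ab (inj₁ ij≈ab)        = samePair-oriented ij≈ab oᵢⱼ
      side-ab (inj₂ (inj₁ ij≈bc)) = oriented-sym (oriented-triangle
        (oriented-sym (samePair-oriented ij≈bc oᵢⱼ)) (linked-sym lab) (linked-sym lac))
      side-ab (inj₂ (inj₂ ij≈ac)) = oriented-triangle
        (oriented-sym (samePair-oriented ij≈ac oᵢⱼ)) lab (linked-sym lbc)

    side-oriented : AllOriented s (a , b , c) → Adj G i j → InTri i a b c → InTri j a b c → Oriented P s i j
    side-oriented (oab , obc , oac) ij i∈T j∈T with edge-is-side ij i∈T j∈T
    ... | inj₁ ij≈ab        = samePair-oriented (samePair-sym ij≈ab) oab
    ... | inj₂ (inj₁ ij≈bc) = samePair-oriented (samePair-sym ij≈bc) obc
    ... | inj₂ (inj₂ ij≈ac) = samePair-oriented (samePair-sym ij≈ac) oac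

    shareEdge-oriented : ∀ {T₁ T₂ : Triangle G} → ShareEdge {G = G} T₁ T₂ →
      AllOriented s (proj₁ T₁) → AllOriented s (proj₁ T₂)
    shareEdge-oriented {T₁ = (_ , _ , _) , _} {(_ , _ , _) , ab , bc , ac}
      (((_ , _) , ij) , (i∈T₁ , j∈T₁) , (i∈T₂ , j∈T₂)) =
      triangle-oriented ab bc ac ij i∈T₂ j∈T₂ ∘ λ o₁ → side-oriented o₁ ij i∈T₁ j∈T₁

    star-oriented : ∀ {T T' : Triangle G} → Star (ShareEdge {G = G}) T T' →
      AllOriented s (proj₁ T) → AllOriented s (proj₁ T')
    star-oriented ε                      = id
    star-oriented {s = s} (_◅_ {i = T₁} {j = T₂} share path) =
      star-oriented path ∘ shareEdge-oriented {s = s} {T₁} {T₂} share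

    triEquiv-oriented : (ij : Adj G i j) (kl : Adj G k l) →
      TriEquiv {G = G} ((i , j) , ij) ((k , l) , kl) → Oriented P s i j → Oriented P s k l
    triEquiv-oriented _ _ (inj₁ same) = samePair-oriented same
    triEquiv-oriented ij kl
      (inj₂ (((_ , _ , _) , ab , bc , ac) , ((_ , _ , _) , _) , (i∈T₁ , j∈T₁) , (k∈Tₗ , l∈Tₗ) , path)) oᵢⱼ =
      side-oriented (star-oriented path (triangle-oriented ab bc ac ij i∈T₁ j∈T₁ oᵢⱼ)) kl k∈Tₗ l∈Tₗ

    uniformly-oriented : TriangleConnected G → Σ Bool (UniformlyOriented P)
    uniformly-oriented connected with any? (λ i → any? (adj? G i))
    ... | no no-edge = true , λ i j adj → ⊥-elim (no-edge (i , j , adj))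
    ... | yes (i₀ , j₀ , adj₀) = proj₁ (adj⇒linked adj₀) , λ i j adj →
      triEquiv-oriented adj₀ adj (connected ((i₀ , j₀) , adj₀) ((i , j) , adj)) (proj₂ (adj⇒linked adj₀))

    module _ (uniform : UniformlyOriented P s) where
      ⋖⇒polarity : x ⋖ y → polarity x ≡ s
      ⋖⇒polarity x⋖y = oriented-unique (⋖⇒oriented x⋖y) (uniform _ _ (⋖⇒adj x⋖y))

      uniform-<⇒⋖ : x < y → x ⋖ y
      uniform-<⇒⋖ = no-⋖-chain⇒<⇒⋖ no-chain
        where
        open ≡-Reasoning
        no-chain : x ⋖ y → y ⋖ z → ⊥
        no-chain {x} {y} x⋖y y⋖z = not-¬ refl (begin
          s                  ≡⟨ sym (⋖⇒polarity y⋖z) ⟩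
          polarity y         ≡⟨ ⋖⇒polarity-flip x⋖y ⟩
          not (polarity x)   ≡⟨ cong not (⋖⇒polarity x⋖y) ⟩
          not s              ∎)

  uniform-<⇒< : ∀ {P Q} (P∈G : InPG G P) (Q∈G : InPG G Q) →
    UniformlyOriented P s → UniformlyOriented Q s → x <[ P ] y → x <[ Q ] y
  uniform-<⇒< {s = s} {x = x} {y = y} {P = P} {Q = Q} P∈G Q∈G uP uQ x<y =
    [ proj₁ , ⊥-elim ∘ polarity-clash ] (⋖-transfer {P = P} {Q = Q} {x = x} {y = y} (proj₂ P∈G) (proj₂ Q∈G) x⋖y)
    where
    open ≡-Reasoning
    x⋖y : Cov P x y
    x⋖y = Orientation.uniform-<⇒⋖ P∈G uP x<y
    polarity-clash : Cov Q (neg x) (neg y) → ⊥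
    polarity-clash x̄⋖ȳ = not-¬ refl (begin
      s                ≡⟨ sym (Orientation.⋖⇒polarity Q∈G uQ x̄⋖ȳ) ⟩
      polarity (neg x) ≡⟨ polarity-neg x ⟩
      not (polarity x) ≡⟨ cong not (Orientation.⋖⇒polarity P∈G uP x⋖y) ⟩
      not s            ∎)

  uniform⇒≈R : ∀ {P Q} → InPG G P → InPG G Q → UniformlyOriented P s → UniformlyOriented Q s → P ≈R Q
  uniform⇒≈R P∈G Q∈G uP uQ x y = ⇔→≡ (mk⇔ (uniform-<⇒< P∈G Q∈G uP uQ) (uniform-<⇒< Q∈G P∈G uQ uP))

lemma8 : (n : ℕ) (G : CGraph n) → InBn G → TriangleConnected G →
    (P₁ P₂ P₃ : Rel n) → InPG G P₁ → InPG G P₂ → InPG G P₃ →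
    (P₁ ≈R P₂) ⊎ (P₁ ≈R P₃) ⊎ (P₂ ≈R P₃)
lemma8 n G (_ , bip) connected P₁ P₂ P₃ P₁∈G P₂∈G P₃∈G =
  two-agree (uniformly-oriented P₁∈G connected)
            (uniformly-oriented P₂∈G connected)
            (uniformly-oriented P₃∈G connected)
  where
  open BlueBipartition bip
  open Orientation using (uniformly-oriented)

  two-agree : Σ Bool (UniformlyOriented P₁) → Σ Bool (UniformlyOriented P₂) → Σ Bool (UniformlyOriented P₃) →
    (P₁ ≈R P₂) ⊎ (P₁ ≈R P₃) ⊎ (P₂ ≈R P₃)
  two-agree (s₁ , u₁) (s₂ , u₂) (s₃ , u₃) with Bool-pigeonhole s₁ s₂ s₃
  ... | inj₁ refl        = inj₁ (uniform⇒≈R P₁∈G P₂∈G u₁ u₂)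
  ... | inj₂ (inj₁ refl) = inj₂ (inj₁ (uniform⇒≈R P₁∈G P₃∈G u₁ u₃))
  ... | inj₂ (inj₂ refl) = inj₂ (inj₂ (uniform⇒≈R P₂∈G P₃∈G u₂ u₃))
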